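{- Let $p\ge 1$, let $n_1,\dots,n_p$ be pairwise distinct positive integers (indexed so that $n_i>n_j$ whenever $i>j$), and let $\theta_1,\dots,\theta_p$ be positive integers. Let $G$ be the complete multipartite graph $K_{n_1,\ldots,n_1,\ldots,n_p,\ldots,n_p}$, in which the size $n_i$ occurs $\theta_i$ times; that is, its vertex set is partitioned into pairwise disjoint independent sets (parts) $P^i_j$ with $1\le i\le p$, $1\le j\le \theta_i$ and $|P^i_j|=n_i$, and two vertices are adjacent if and only if they lie in distinct parts. Then the FAT chromatic number of $G$ is \[ \chi^{\mathrm{FAT}}(G)=\begin{cases}\max\{\theta_1,n_1\}, & \text{if } p=1,\\[1mm] 2, & \text{if } p=2,\ \gcd\{n_1,n_2\}=1, \text{ and } \theta_1(\theta_1-1)n_1^2=\theta_2(\theta_2-1)n_2^2,\\[1mm] \gcd\{n_i: i=1,\dots,p\}, & \text{otherwise.}\end{cases} \]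
   Context: All graphs are finite, simple (undirected, unweighted, no loops, no multiple edges). For a vertex $v$ and a set $S\subseteq V$, $e(v,S)$ denotes the number of neighbors of $v$ in $S$. A $k$-coloring of $G$ is a function $c:V\to\{1,\dots,k\}$ with coloring classes $V_i=c^{ -1}(i)$. A $k$-coloring is Fair and Tolerant (FAT) if there is a parameter $\alpha\in[0,1]$ such that, with $\beta:=1-(k-1)\alpha$, every vertex $v$ satisfies $e(v,V_i)=\alpha\deg v$ for every class $V_i$ with $v\notin V_i$, and $e(v,V_i)=\beta\deg v$ for the class $V_i$ containing $v$. The FAT chromatic number $\chi^{\mathrm{FAT}}(G)$ is the largest integer $k$ such that $G$ admits a FAT $k$-coloring (every graph admits the FAT $1$-coloring).
   Formalization: The parameter α of a FAT coloring ranges over the rationals in $[0,1]$. -}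

module Defs where

open import Data.Nat as ℕ using (ℕ; zero; suc; _+_; _*_; _∸_; _≤_; _<_; _⊔_; _≡ᵇ_)
open import Data.Nat.GCD using (gcd)
open import Data.Bool using (Bool; true; false; _∧_; if_then_else_)
open import Data.Fin using (Fin; zero; suc; _≟_; toℕ)
open import Data.Integer using (+_)
open import Data.Rational as ℚ using (ℚ; 0ℚ; 1ℚ)
open import Data.Product using (Σ; ∃; _×_; _,_)
open import Relation.Binary.PropositionalEquality using (_≡_; _≢_; refl)
open import Relation.Nullary using (yes; no)
open import Relation.Nullary.Decidable using (⌊_⌋)

record Graph (N : ℕ) : Set where
  field
    adj    : Fin N → Fin N → Bool
    sym    : ∀ u v → adj u v ≡ adj v u
    irrefl : ∀ v → adj v v ≡ false
open Graph public

count : ∀ {N} → (Fin N → Bool) → ℕ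
count {zero}  P = 0
count {suc N} P = (if P zero then 1 else 0) + count {N} (λ x → P (suc x))

ℕtoℚ : ℕ → ℚ
ℕtoℚ n = (+ n) ℚ./ 1

deg : ∀ {N} → Graph N → Fin N → ℕ
deg G v = count (adj G v)

eClass : ∀ {N k} → Graph N → (Fin N → Fin k) → Fin N → Fin k → ℕ
eClass G c v i = count (λ u → adj G v u ∧ ⌊ c u ≟ i ⌋)

-- a k-colouring c is FAT (with parameter α ∈ [0,1], β = 1 - (k-1)α);
-- colourings are surjective (k nonempty classes)
IsFATColoring : ∀ {N} → Graph N → (k : ℕ) → (Fin N → Fin k) → Set
IsFATColoring {N} G k c =
  (∀ (i : Fin k) → ∃ λ v → c v ≡ i) ×
  Σ ℚ λ α → (0ℚ ℚ.≤ α) × (α ℚ.≤ 1ℚ) ×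
    (∀ (v : Fin N) (i : Fin k) →
       (c v ≢ i → ℕtoℚ (eClass G c v i) ≡ α ℚ.* ℕtoℚ (deg G v)) ×
       (c v ≡ i → ℕtoℚ (eClass G c v i)
                    ≡ (1ℚ ℚ.- ℕtoℚ (k ∸ 1) ℚ.* α) ℚ.* ℕtoℚ (deg G v)))

HasFATColoring : ∀ {N} → Graph N → ℕ → Set
HasFATColoring {N} G k = Σ (Fin N → Fin k) (IsFATColoring G k)

FATChromaticNumber≡ : ∀ {N} → Graph N → ℕ → Set
FATChromaticNumber≡ G m = HasFATColoring G m × (∀ k → HasFATColoring G k → k ≤ m)

PartLabel : (p : ℕ) → (Fin p → ℕ) → Set
PartLabel p θ = Σ (Fin p) (λ i → Fin (θ i))

partEqᵇ : ∀ {p} {θ : Fin p → ℕ} → PartLabel p θ → PartLabel p θ → Bool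
partEqᵇ (i , j) (i' , j') with i ≟ i'
... | yes refl = ⌊ j ≟ j' ⌋
... | no _ = false

IsCompleteMultipartite : ∀ {N} (p : ℕ) (n θ : Fin p → ℕ) →
  Graph N → (Fin N → PartLabel p θ) → Set
IsCompleteMultipartite {N} p n θ G part =
  (∀ (i : Fin p) (j : Fin (θ i)) → count (λ v → partEqᵇ (part v) (i , j)) ≡ n i) ×
  (∀ u v → (adj G u v ≡ true → part u ≢ part v) × (part u ≢ part v → adj G u v ≡ true))

gcdAll : ∀ {p} → (Fin p → ℕ) → ℕ
gcdAll {zero}  n = 0
gcdAll {suc p} n = gcd (n zero) (gcdAll {p} (λ i → n (suc i)))

-- the claimed value of χ^FAT; index zero corresponds to n₁, θ₁
fatValue : (p : ℕ) → (n θ : Fin p → ℕ) → ℕ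
fatValue (suc zero) n θ = θ zero ⊔ n zero
fatValue (suc (suc zero)) n θ =
  if (gcd (n zero) (n (suc zero)) ≡ᵇ 1)
     ∧ (θ zero * (θ zero ∸ 1) * (n zero * n zero)
          ≡ᵇ θ (suc zero) * (θ (suc zero) ∸ 1) * (n (suc zero) * n (suc zero)))
  then 2 else gcdAll n
fatValue p n θ = gcdAll n

{-# OPTIONS --safe #-}
-- Write s(i) for the size of the colour class V_i and x(P,i) for the number of vertices of colour i
-- in a part P, so that a vertex of P has e(v,V_i) = s(i) - x(P,i).  If a part contains vertices
-- u, w of different colours, they have the same neighbourhood and degree d, so
-- α·d = e(u,V_c(w)) = e(w,V_c(w)) = β·d forces α = β: every vertex sees all classes equally.  Summing
-- s(i) - x(P,i) = s(j) - x(P,j) over the (at least two) parts gives s(i) = s(j), hence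
-- x(P,i) = x(P,j), so the number k of colours divides every part size and k ≤ gcd{n_i}.
-- Otherwise every part is monochromatic, so e(v,V_i) = s(i) for i ≠ c(v), and α·deg v = s(i)
-- shows that two vertices avoiding a common colour have the same degree, i.e. parts of the same
-- size.  As the n_i are distinct, k ≥ 3 forces p = 1, and vertices of different sizes get different
-- colours.  For p = 1 the colouring is a colouring of the θ₁ parts; for p = 2 the two size classes
-- are the two colour classes, which is FAT exactly when θ₁(θ₁-1)n₁² = θ₂(θ₂-1)n₂²; for p ≥ 3 no
-- such colouring with k ≥ 2 exists.  Conversely, colouring every part cyclically by rank modulo
-- gcd{n_i}, colouring by parts (p = 1, θ₁ ≥ 2) and colouring by size classes (p = 2, balanced)
-- are FAT colourings attaining the bound.
module Submission where

open import Defs hiding (sym)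
open import Data.Bool using (Bool; true; false; _∧_; not; if_then_else_)
open import Data.Bool.Properties using (¬-not; ∧-comm; ∧-identityʳ; ∧-conicalʳ; T-≡)
open import Data.Fin as Fin using (Fin; zero; suc; _≟_; punchIn; fromℕ<; toℕ)
open import Data.Fin.Properties as Fin using (punchInᵢ≢i; injective⇒≤; any?; toℕ-injective; toℕ-fromℕ<; toℕ<n)
import Data.Integer as ℤ
import Data.Integer.Properties as ℤ
open import Data.Nat as ℕ using (ℕ; zero; suc; _+_; _*_; _∸_; _⊔_; _≤_; _<_; z≤n; s≤s; NonZero; >-nonZero; >-nonZero⁻¹)
import Data.Nat.Coprimality as Coprime
open import Data.Nat.Divisibility using (_∣_; divides; ∣⇒≤; _∣0; ∣-trans)
open import Data.Nat.DivMod using (_mod_; _%_; [m+n]%n≡m%n; m<n⇒m%n≡m)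
open import Data.Nat.GCD using (gcd; gcd[m,n]∣m; gcd[m,n]∣n; gcd-greatest; gcd[m,n]≢0; gcd-identityʳ)
open import Data.Nat.Properties hiding (_≟_)
open import Data.Nat.Tactic.RingSolver using (solve-∀)
open import Algebra.Properties.CommutativeSemigroup +-commutativeSemigroup using (x∙yz≈y∙xz)
open import Algebra.Properties.Semiring.Sum +-*-semiring
  using (sum-syntax; sum-cong-≗; sum-replicate-zero; sum-remove; ∑-comm; ∑-distrib-+; *-distribʳ-sum)
open import Data.Product using (∃; ∃₂; _×_; _,_; proj₁; proj₂)
open import Data.Product.Properties using (≡-dec)
open import Data.Rational as ℚ using (ℚ; mkℚ; 0ℚ; 1ℚ; 1/_)
open import Data.Rational.Properties as ℚ using (normalize-coprime; /-cong)
open import Data.Rational.Solver using (module +-*-Solver)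
open import Data.Sum using (_⊎_; inj₁; inj₂; [_,_]′)
open import Function using (_∘_; Equivalence; mk⇔)
open import Relation.Binary.Definitions using (DecidableEquality; tri<; tri≈; tri>)
open import Relation.Binary.PropositionalEquality
open import Relation.Nullary using (Dec; yes; no; ¬_; contradiction; ¬?; _×-dec_)
open import Relation.Nullary.Decidable
  using (⌊_⌋; ⌊⌋-map′; isYes≗does; does-⇔; dec-true; dec-false; toWitness; decidable-stable; toSum)

𝟙 : Bool → ℕ
𝟙 b = if b then 1 else 0

⌊⌋-yes : ∀ {A : Set} (a? : Dec A) → A → ⌊ a? ⌋ ≡ true
⌊⌋-yes a? a = trans (isYes≗does a?) (dec-true a? a)

⌊⌋-no : ∀ {A : Set} (a? : Dec A) → ¬ A → ⌊ a? ⌋ ≡ false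
⌊⌋-no a? ¬a = trans (isYes≗does a?) (dec-false a? ¬a)

⌊⌋-sound : ∀ {A : Set} (a? : Dec A) → ⌊ a? ⌋ ≡ true → A
⌊⌋-sound a? a?≡true = toWitness {a? = a?} (Equivalence.from T-≡ a?≡true)

⌊⌋-⇔ : ∀ {A B : Set} → (A → B) → (B → A) → (a? : Dec A) (b? : Dec B) → ⌊ a? ⌋ ≡ ⌊ b? ⌋
⌊⌋-⇔ A→B B→A a? b? = trans (isYes≗does a?) (trans (does-⇔ (mk⇔ A→B B→A) a? b?) (sym (isYes≗does b?)))

≡ᵇ-sound : ∀ {m n} → (m ℕ.≡ᵇ n) ≡ true → m ≡ n
≡ᵇ-sound {m} {n} m≡ᵇn = ≡ᵇ⇒≡ m n (Equivalence.from T-≡ m≡ᵇn)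

≡ᵇ-complete : ∀ {m n} → m ≡ n → (m ℕ.≡ᵇ n) ≡ true
≡ᵇ-complete {m} {n} m≡n = Equivalence.to T-≡ (≡⇒≡ᵇ m n m≡n)

∑-const : ∀ n x → ∑[ i < n ] x ≡ n * x
∑-const zero x = refl
∑-const (suc n) x = cong (x +_) (∑-const n x)

∑-mono-≤ : ∀ {n} {f g : Fin n → ℕ} → (∀ i → f i ≤ g i) → ∑[ i < n ] f i ≤ ∑[ i < n ] g i
∑-mono-≤ {zero} _ = z≤n
∑-mono-≤ {suc n} f≤g = +-mono-≤ (f≤g zero) (∑-mono-≤ (f≤g ∘ suc))

∑-𝟙-≟ : ∀ {k} (j : Fin k) → ∑[ i < k ] 𝟙 ⌊ j ≟ i ⌋ ≡ 1
∑-𝟙-≟ {suc k} zero = cong suc (sum-replicate-zero k)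
∑-𝟙-≟ {suc k} (suc j) = trans (sum-cong-≗ (λ i → cong 𝟙 (⌊⌋-map′ _ _ (j ≟ i)))) (∑-𝟙-≟ j)

∑-𝟙-∧-≟ : ∀ {k} b (j : Fin k) → ∑[ i < k ] 𝟙 (b ∧ ⌊ j ≟ i ⌋) ≡ 𝟙 b
∑-𝟙-∧-≟ {k} false j = sum-replicate-zero k
∑-𝟙-∧-≟ true j = ∑-𝟙-≟ j

count≡∑ : ∀ {N} (P : Fin N → Bool) → count P ≡ ∑[ x < N ] 𝟙 (P x)
count≡∑ {zero} P = refl
count≡∑ {suc N} P = cong (𝟙 (P zero) +_) (count≡∑ (P ∘ suc))

count-cong : ∀ {N} {P Q : Fin N → Bool} → (∀ x → P x ≡ Q x) → count P ≡ count Q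
count-cong {zero} _ = refl
count-cong {suc N} P≗Q = cong₂ _+_ (cong 𝟙 (P≗Q zero)) (count-cong (P≗Q ∘ suc))

count-all : ∀ {N} (P : Fin N → Bool) → (∀ x → P x ≡ true) → count P ≡ N
count-all {zero} _ _ = refl
count-all {suc N} P all rewrite all zero = cong suc (count-all (P ∘ suc) (all ∘ suc))

count-none : ∀ {N} (P : Fin N → Bool) → (∀ x → P x ≡ false) → count P ≡ 0
count-none {zero} _ _ = refl
count-none {suc N} P none rewrite none zero = count-none (P ∘ suc) (none ∘ suc)

count-pos : ∀ {N} (P : Fin N → Bool) x → P x ≡ true → 0 < count P
count-pos P zero Px rewrite Px = s≤s z≤n
count-pos P (suc x) Px with P zero
... | true = s≤s z≤n
... | false = count-pos (P ∘ suc) x Px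

count-witness : ∀ {N} (P : Fin N → Bool) → 0 < count P → ∃ λ x → P x ≡ true
count-witness {suc N} P pos with P zero in P0
... | true = zero , P0
... | false with count-witness (P ∘ suc) pos
...   | x , Px = suc x , Px

count-split : ∀ {N} (P Q : Fin N → Bool) →
  count Q ≡ count (λ x → P x ∧ Q x) + count (λ x → not (P x) ∧ Q x)
count-split {N} P Q = begin
  count Q
    ≡⟨ count≡∑ Q ⟩
  ∑[ x < N ] 𝟙 (Q x)
    ≡⟨ sum-cong-≗ (λ x → 𝟙-split (P x) (Q x)) ⟩
  ∑[ x < N ] (𝟙 (P x ∧ Q x) + 𝟙 (not (P x) ∧ Q x))
    ≡⟨ ∑-distrib-+ (λ x → 𝟙 (P x ∧ Q x)) (λ x → 𝟙 (not (P x) ∧ Q x)) ⟩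
  ∑[ x < N ] 𝟙 (P x ∧ Q x) + ∑[ x < N ] 𝟙 (not (P x) ∧ Q x)
    ≡⟨ cong₂ _+_ (count≡∑ (λ x → P x ∧ Q x)) (count≡∑ (λ x → not (P x) ∧ Q x)) ⟨
  count (λ x → P x ∧ Q x) + count (λ x → not (P x) ∧ Q x) ∎
  where
  open ≡-Reasoning
  𝟙-split : ∀ a b → 𝟙 b ≡ 𝟙 (a ∧ b) + 𝟙 (not a ∧ b)
  𝟙-split false false = refl
  𝟙-split false true = refl
  𝟙-split true false = refl
  𝟙-split true true = refl

count-complement : ∀ {N} (P : Fin N → Bool) → count P + count (not ∘ P) ≡ N
count-complement {N} P = begin
  count P + count (not ∘ P)
    ≡⟨ cong₂ _+_ (count-cong (sym ∘ ∧-identityʳ ∘ P)) (count-cong (sym ∘ ∧-identityʳ ∘ not ∘ P)) ⟩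
  count (λ x → P x ∧ true) + count (λ x → not (P x) ∧ true)
    ≡⟨ count-split P (λ _ → true) ⟨
  count {N} (λ _ → true)
    ≡⟨ count-all _ (λ _ → refl) ⟩
  N ∎
  where open ≡-Reasoning

count-partition : ∀ {N k} (c : Fin N → Fin k) (P : Fin N → Bool) →
  count P ≡ ∑[ i < k ] count (λ x → P x ∧ ⌊ c x ≟ i ⌋)
count-partition {N} {k} c P = begin
  count P
    ≡⟨ count≡∑ P ⟩
  ∑[ x < N ] 𝟙 (P x)
    ≡⟨ sum-cong-≗ (λ x → ∑-𝟙-∧-≟ (P x) (c x)) ⟨
  ∑[ x < N ] ∑[ i < k ] 𝟙 (P x ∧ ⌊ c x ≟ i ⌋)
    ≡⟨ ∑-comm (λ x i → 𝟙 (P x ∧ ⌊ c x ≟ i ⌋)) ⟩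
  ∑[ i < k ] ∑[ x < N ] 𝟙 (P x ∧ ⌊ c x ≟ i ⌋)
    ≡⟨ sum-cong-≗ (λ i → count≡∑ (λ x → P x ∧ ⌊ c x ≟ i ⌋)) ⟨
  ∑[ i < k ] count (λ x → P x ∧ ⌊ c x ≟ i ⌋) ∎
  where open ≡-Reasoning

ℕtoℚ≡mkℚ : ∀ n → ℕtoℚ n ≡ mkℚ (ℤ.+ n) 0 (Coprime.sym (Coprime.1-coprimeTo n))
ℕtoℚ≡mkℚ n = normalize-coprime _

ℕtoℚ-+ : ∀ m n → ℕtoℚ (m + n) ≡ ℕtoℚ m ℚ.+ ℕtoℚ n
ℕtoℚ-+ m n rewrite ℕtoℚ≡mkℚ m | ℕtoℚ≡mkℚ n =
  /-cong (sym (cong₂ ℤ._+_ (ℤ.*-identityʳ (ℤ.+ m)) (ℤ.*-identityʳ (ℤ.+ n)))) refl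

ℕtoℚ-* : ∀ m n → ℕtoℚ (m * n) ≡ ℕtoℚ m ℚ.* ℕtoℚ n
ℕtoℚ-* m n rewrite ℕtoℚ≡mkℚ m | ℕtoℚ≡mkℚ n = /-cong (ℤ.pos-* m n) refl

ℕtoℚ-injective : ∀ {m n} → ℕtoℚ m ≡ ℕtoℚ n → m ≡ n
ℕtoℚ-injective {m} {n} eq =
  ℤ.+-injective (cong ℚ.numerator (trans (sym (ℕtoℚ≡mkℚ m)) (trans eq (ℕtoℚ≡mkℚ n))))

ℕtoℚ-mono-≤ : ∀ {m n} → m ≤ n → ℕtoℚ m ℚ.≤ ℕtoℚ n
ℕtoℚ-mono-≤ {m} {n} m≤n rewrite ℕtoℚ≡mkℚ m | ℕtoℚ≡mkℚ n =
  ℚ.*≤* (ℤ.*-monoʳ-≤-nonNeg (ℤ.+ 1) (ℤ.+≤+ m≤n))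

ℕtoℚ-cross : ∀ α x d y e → ℕtoℚ x ≡ α ℚ.* ℕtoℚ d → ℕtoℚ y ≡ α ℚ.* ℕtoℚ e → x * e ≡ y * d
ℕtoℚ-cross α x d y e x≡αd y≡αe = ℕtoℚ-injective (begin
  ℕtoℚ (x * e)
    ≡⟨ ℕtoℚ-* x e ⟩
  ℕtoℚ x ℚ.* ℕtoℚ e
    ≡⟨ cong (ℚ._* ℕtoℚ e) x≡αd ⟩
  α ℚ.* ℕtoℚ d ℚ.* ℕtoℚ e
    ≡⟨ solve 3 (λ a d e → a :* d :* e := a :* e :* d) refl α (ℕtoℚ d) (ℕtoℚ e) ⟩
  α ℚ.* ℕtoℚ e ℚ.* ℕtoℚ d
    ≡⟨ cong (ℚ._* ℕtoℚ d) y≡αe ⟨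
  ℕtoℚ y ℚ.* ℕtoℚ d
    ≡⟨ ℕtoℚ-* y d ⟨
  ℕtoℚ (y * d) ∎)
  where open ≡-Reasoning; open +-*-Solver

ℕtoℚ-complement : ∀ α d o k e → d ≡ o + k * e → ℕtoℚ e ≡ α ℚ.* ℕtoℚ d →
  ℕtoℚ o ≡ (1ℚ ℚ.- ℕtoℚ k ℚ.* α) ℚ.* ℕtoℚ d
ℕtoℚ-complement α d o k e d≡o+ke e≡αd = sym (begin
  (1ℚ ℚ.- K ℚ.* α) ℚ.* D
    ≡⟨ solve 3 (λ k a d → (con 1ℚ :- k :* a) :* d := d :- k :* (a :* d)) refl K α D ⟩
  D ℚ.- K ℚ.* (α ℚ.* D)
    ≡⟨ cong (λ t → D ℚ.- K ℚ.* t) e≡αd ⟨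
  D ℚ.- K ℚ.* ℕtoℚ e
    ≡⟨ cong (ℚ._- K ℚ.* ℕtoℚ e) (trans (cong ℕtoℚ d≡o+ke) (trans (ℕtoℚ-+ o _) (cong (ℕtoℚ o ℚ.+_) (ℕtoℚ-* k e)))) ⟩
  ℕtoℚ o ℚ.+ K ℚ.* ℕtoℚ e ℚ.- K ℚ.* ℕtoℚ e
    ≡⟨ solve 3 (λ o k e → o :+ k :* e :- k :* e := o) refl (ℕtoℚ o) K (ℕtoℚ e) ⟩
  ℕtoℚ o ∎)
  where open ≡-Reasoning; open +-*-Solver; K = ℕtoℚ k; D = ℕtoℚ d

module _ (a b : ℕ) .{{_ : NonZero b}} where

  private instance
    b>0 : ℚ.Positive (ℕtoℚ b)
    b>0 = ℚ.normalize-pos b 1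
    b≢0 : ℚ.NonZero (ℕtoℚ b)
    b≢0 = ℚ.pos⇒nonZero (ℕtoℚ b)

  ratio : ℚ
  ratio = ℕtoℚ a ℚ.* 1/ ℕtoℚ b

  ratio-*-denominator : ratio ℚ.* ℕtoℚ b ≡ ℕtoℚ a
  ratio-*-denominator = begin
    ℕtoℚ a ℚ.* 1/ ℕtoℚ b ℚ.* ℕtoℚ b     ≡⟨ ℚ.*-assoc (ℕtoℚ a) _ _ ⟩
    ℕtoℚ a ℚ.* (1/ ℕtoℚ b ℚ.* ℕtoℚ b)   ≡⟨ cong (ℕtoℚ a ℚ.*_) (ℚ.*-inverseˡ (ℕtoℚ b)) ⟩
    ℕtoℚ a ℚ.* 1ℚ                       ≡⟨ ℚ.*-identityʳ (ℕtoℚ a) ⟩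
    ℕtoℚ a                              ∎
    where open ≡-Reasoning

  ℕtoℚ≡ratio : ∀ e d → e * b ≡ a * d → ℕtoℚ e ≡ ratio ℚ.* ℕtoℚ d
  ℕtoℚ≡ratio e d eb≡ad = begin
    ℕtoℚ e
      ≡⟨ ℚ.*-identityʳ (ℕtoℚ e) ⟨
    ℕtoℚ e ℚ.* 1ℚ
      ≡⟨ cong (ℕtoℚ e ℚ.*_) (ℚ.*-inverseʳ (ℕtoℚ b)) ⟨
    ℕtoℚ e ℚ.* (ℕtoℚ b ℚ.* r)
      ≡⟨ ℚ.*-assoc (ℕtoℚ e) _ _ ⟨
    ℕtoℚ e ℚ.* ℕtoℚ b ℚ.* r
      ≡⟨ cong (ℚ._* r) (trans (sym (ℕtoℚ-* e b)) (trans (cong ℕtoℚ eb≡ad) (ℕtoℚ-* a d))) ⟩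
    ℕtoℚ a ℚ.* ℕtoℚ d ℚ.* r
      ≡⟨ solve 3 (λ a d r → a :* d :* r := a :* r :* d) refl (ℕtoℚ a) (ℕtoℚ d) r ⟩
    ℕtoℚ a ℚ.* r ℚ.* ℕtoℚ d ∎
    where open ≡-Reasoning; open +-*-Solver; r = 1/ ℕtoℚ b

  ratio-nonNeg : 0ℚ ℚ.≤ ratio
  ratio-nonNeg = ℚ.*-cancelʳ-≤-pos (ℕtoℚ b)
    (subst₂ ℚ._≤_ (sym (ℚ.*-zeroˡ (ℕtoℚ b))) (sym ratio-*-denominator) (ℕtoℚ-mono-≤ {n = a} z≤n))

  ratio≤1 : a ≤ b → ratio ℚ.≤ 1ℚ
  ratio≤1 a≤b = ℚ.*-cancelʳ-≤-pos (ℕtoℚ b)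
    (subst₂ ℚ._≤_ (sym ratio-*-denominator) (sym (ℚ.*-identityˡ (ℕtoℚ b))) (ℕtoℚ-mono-≤ a≤b))

-- FAT colourings of arbitrary graphs

deg≡∑eClass : ∀ {N k} (G : Graph N) (c : Fin N → Fin k) v → deg G v ≡ ∑[ i < k ] eClass G c v i
deg≡∑eClass G c v = count-partition c (adj G v)

deg≡own+others : ∀ {N k} (G : Graph N) (c : Fin N → Fin k) v {e} →
  (∀ i → c v ≢ i → eClass G c v i ≡ e) → deg G v ≡ eClass G c v (c v) + (k ∸ 1) * e
deg≡own+others {k = zero} G c v _ with c v
... | ()
deg≡own+others {k = suc k} G c v {e} others = begin
  deg G v
    ≡⟨ deg≡∑eClass G c v ⟩
  ∑[ i < suc k ] eClass G c v i
    ≡⟨ sum-remove {i = c v} (eClass G c v) ⟩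
  eClass G c v (c v) + ∑[ j < k ] eClass G c v (punchIn (c v) j)
    ≡⟨ cong (eClass G c v (c v) +_) (sum-cong-≗ (λ j → others _ (punchInᵢ≢i (c v) j ∘ sym))) ⟩
  eClass G c v (c v) + ∑[ j < k ] e
    ≡⟨ cong (eClass G c v (c v) +_) (∑-const k e) ⟩
  eClass G c v (c v) + k * e ∎
  where open ≡-Reasoning

surjective⇒≤ : ∀ {N k} (c : Fin N → Fin k) → (∀ i → ∃ λ v → c v ≡ i) → k ≤ N
surjective⇒≤ c surjective = injective⇒≤ {f = proj₁ ∘ surjective} λ {i} {j} same →
  trans (sym (proj₂ (surjective i))) (trans (cong c same) (proj₂ (surjective j)))

-- The own-class condition is automatic, as deg v is the sum of e(v,V_i) over all classes.
isFATColoring-byRatio : ∀ {N k} (G : Graph N) (c : Fin N → Fin k) → (∀ i → ∃ λ v → c v ≡ i) →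
  ∀ a b .{{_ : NonZero b}} → a ≤ b →
  (∀ v → ∃ λ e → (∀ i → c v ≢ i → eClass G c v i ≡ e) × e * b ≡ a * deg G v) →
  IsFATColoring G k c
isFATColoring-byRatio {k = k} G c surjective a b a≤b offDiagonal =
  surjective , ratio a b , ratio-nonNeg a b , ratio≤1 a b a≤b , λ v i → others v i , own v i
  where
  others : ∀ v i → c v ≢ i → ℕtoℚ (eClass G c v i) ≡ ratio a b ℚ.* ℕtoℚ (deg G v)
  others v i cv≢i = let (e , off , eb≡ad) = offDiagonal v in
    trans (cong ℕtoℚ (off i cv≢i)) (ℕtoℚ≡ratio a b e (deg G v) eb≡ad)
  own : ∀ v i → c v ≡ i → ℕtoℚ (eClass G c v i) ≡ (1ℚ ℚ.- ℕtoℚ (k ∸ 1) ℚ.* ratio a b) ℚ.* ℕtoℚ (deg G v)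
  own v _ refl = let (e , off , eb≡ad) = offDiagonal v in
    ℕtoℚ-complement (ratio a b) (deg G v) (eClass G c v (c v)) (k ∸ 1) e
      (deg≡own+others G c v off) (ℕtoℚ≡ratio a b e (deg G v) eb≡ad)

suc[m∸1]≡m : ∀ {m} → 0 < m → suc (m ∸ 1) ≡ m
suc[m∸1]≡m {suc m} _ = refl

a+m*b≡b+m*a⇒a≡b : ∀ a b {m} → 2 ≤ m → a + m * b ≡ b + m * a → a ≡ b
a+m*b≡b+m*a⇒a≡b a b {suc zero} (s≤s ()) _
a+m*b≡b+m*a⇒a≡b a b {suc (suc m)} _ eq = sym (*-cancelˡ-≡ b a (suc m) (+-cancelˡ-≡ (a + b) _ _ (begin
  a + b + suc m * b   ≡⟨ +-assoc a b _ ⟩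
  a + suc (suc m) * b ≡⟨ eq ⟩
  b + suc (suc m) * a ≡⟨ +-assoc b a _ ⟨
  b + a + suc m * a   ≡⟨ cong (_+ suc m * a) (+-comm b a) ⟩
  a + b + suc m * a   ∎)))
  where open ≡-Reasoning

-- A vertex of degree d in a part of size m, inside a group of θ such parts with s vertices outside it.
square-split : ∀ θ m d s → 0 < θ → m + d ≡ θ * m + s → θ * m * d ≡ θ * (θ ∸ 1) * (m * m) + θ * m * s
square-split (suc t) m d s _ m+d≡ = +-cancelˡ-≡ (suc t * m * m) _ _ (begin
  suc t * m * m + suc t * m * d           ≡⟨ *-distribˡ-+ (suc t * m) m d ⟨
  suc t * m * (m + d)                     ≡⟨ cong (suc t * m *_) m+d≡ ⟩
  suc t * m * (suc t * m + s)             ≡⟨ expand t m s ⟩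
  suc t * m * m + (suc t * t * (m * m) + suc t * m * s) ∎)
  where
  open ≡-Reasoning
  expand : ∀ t m s → suc t * m * (suc t * m + s) ≡ suc t * m * m + (suc t * t * (m * m) + suc t * m * s)
  expand = solve-∀

strictlyIncreasing⇒injective : ∀ {p} {n : Fin p → ℕ} → (∀ i j → j Fin.< i → n j < n i) →
  ∀ {a b} → n a ≡ n b → a ≡ b
strictlyIncreasing⇒injective {n = n} increasing {a} {b} na≡nb with Fin.<-cmp a b
... | tri< a<b _ _ = contradiction na≡nb (<⇒≢ (increasing b a a<b))
... | tri≈ _ a≡b _ = a≡b
... | tri> _ _ b<a = contradiction (sym na≡nb) (<⇒≢ (increasing a b b<a))

gcdAll-∣ : ∀ {p} (n : Fin p → ℕ) a → gcdAll n ∣ n a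
gcdAll-∣ {suc p} n zero = gcd[m,n]∣m (n zero) _
gcdAll-∣ {suc p} n (suc a) = ∣-trans (gcd[m,n]∣n (n zero) _) (gcdAll-∣ (n ∘ suc) a)

gcdAll-greatest : ∀ {p} (n : Fin p → ℕ) {d} → (∀ a → d ∣ n a) → d ∣ gcdAll n
gcdAll-greatest {zero} n {d} _ = d ∣0
gcdAll-greatest {suc p} n d∣n = gcd-greatest (d∣n zero) (gcdAll-greatest (n ∘ suc) (d∣n ∘ suc))

gcdAll-pos : ∀ {p} (n : Fin (suc p) → ℕ) → 0 < n zero → 0 < gcdAll n
gcdAll-pos n n₀>0 = n≢0⇒n>0 (gcd[m,n]≢0 (n zero) _ (inj₁ (<⇒≢ n₀>0 ∘ sym)))

avoid₁ : ∀ {k} (x : Fin (2 + k)) → ∃ λ z → x ≢ z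
avoid₁ zero = suc zero , λ ()
avoid₁ (suc _) = zero , λ ()

avoid₂ : ∀ {k} (x y : Fin (3 + k)) → ∃ λ z → x ≢ z × y ≢ z
avoid₂ zero zero = suc zero , (λ ()) , (λ ())
avoid₂ zero (suc zero) = suc (suc zero) , (λ ()) , (λ ())
avoid₂ zero (suc (suc _)) = suc zero , (λ ()) , (λ ())
avoid₂ (suc zero) zero = suc (suc zero) , (λ ()) , (λ ())
avoid₂ (suc (suc _)) zero = suc zero , (λ ()) , (λ ())
avoid₂ (suc _) (suc _) = zero , (λ ()) , (λ ())

other : Fin 2 → Fin 2
other zero = suc zero
other (suc zero) = zero

≢⇒≡other : ∀ {i j : Fin 2} → j ≢ i → i ≡ other j
≢⇒≡other {zero} {zero} j≢i = contradiction refl j≢i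
≢⇒≡other {zero} {suc zero} _ = refl
≢⇒≡other {suc zero} {zero} _ = refl
≢⇒≡other {suc zero} {suc zero} j≢i = contradiction refl j≢i

-- Counting by rank modulo g

rank : ∀ {N} → (Fin N → Bool) → Fin N → ℕ
rank {suc N} Q zero = 0
rank {suc N} Q (suc w) = 𝟙 (Q zero) + rank (Q ∘ suc) w

countBelow : ℕ → (ℕ → Bool) → ℕ
countBelow zero h = 0
countBelow (suc m) h = 𝟙 (h 0) + countBelow m (h ∘ suc)

count-rank : ∀ {N} (Q : Fin N → Bool) (h : ℕ → Bool) →
  count (λ w → Q w ∧ h (rank Q w)) ≡ countBelow (count Q) h
count-rank {zero} Q h = refl
count-rank {suc N} Q h with Q zero
... | true = cong (𝟙 (h 0) +_) (count-rank (Q ∘ suc) (h ∘ suc))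
... | false = count-rank (Q ∘ suc) h

countBelow-+ : ∀ a b h → countBelow (a + b) h ≡ countBelow a h + countBelow b (h ∘ (a +_))
countBelow-+ zero b h = refl
countBelow-+ (suc a) b h = trans (cong (𝟙 (h 0) +_) (countBelow-+ a b (h ∘ suc))) (sym (+-assoc (𝟙 (h 0)) _ _))

countBelow-cong : ∀ m {h h′ : ℕ → Bool} → (∀ r → r < m → h r ≡ h′ r) → countBelow m h ≡ countBelow m h′
countBelow-cong zero _ = refl
countBelow-cong (suc m) h≗h′ = cong₂ _+_ (cong 𝟙 (h≗h′ 0 (s≤s z≤n))) (countBelow-cong m (λ r r<m → h≗h′ (suc r) (s≤s r<m)))

countBelow-≟ : ∀ m t → t < m → countBelow m (λ r → ⌊ r ℕ.≟ t ⌋) ≡ 1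
countBelow-≟ (suc m) zero _ = cong suc (none m)
  where
  none : ∀ m → countBelow m (λ _ → false) ≡ 0
  none zero = refl
  none (suc m) = none m
countBelow-≟ (suc m) (suc t) (s≤s t<m) = trans (countBelow-cong m (λ r _ → ⌊suc≟suc⌋ r)) (countBelow-≟ m t t<m)
  where
  ⌊suc≟suc⌋ : ∀ r → ⌊ suc r ℕ.≟ suc t ⌋ ≡ ⌊ r ℕ.≟ t ⌋
  ⌊suc≟suc⌋ r = trans (isYes≗does (suc r ℕ.≟ suc t)) (sym (isYes≗does (r ℕ.≟ t)))

module _ (g : ℕ) .{{_ : NonZero g}} (i : Fin g) where

  ⌊mod≟⌋ : ∀ r → ⌊ r mod g ≟ i ⌋ ≡ ⌊ r % g ℕ.≟ toℕ i ⌋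
  ⌊mod≟⌋ r with r % g ℕ.≟ toℕ i
  ... | yes r%g≡i = ⌊⌋-yes (r mod g ≟ i) (toℕ-injective (trans (toℕ-fromℕ< _) r%g≡i))
  ... | no r%g≢i = ⌊⌋-no (r mod g ≟ i) (r%g≢i ∘ trans (sym (toℕ-fromℕ< _)) ∘ cong toℕ)

  countBelow-mod : ∀ q → countBelow (q * g) (λ r → ⌊ r mod g ≟ i ⌋) ≡ q
  countBelow-mod zero = refl
  countBelow-mod (suc q) = begin
    countBelow (g + q * g) h
      ≡⟨ countBelow-+ g (q * g) h ⟩
    countBelow g h + countBelow (q * g) (h ∘ (g +_))
      ≡⟨ cong₂ _+_ onePeriod (countBelow-cong (q * g) (λ r _ → periodic r)) ⟩
    1 + countBelow (q * g) h
      ≡⟨ cong suc (countBelow-mod q) ⟩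
    suc q ∎
    where
    open ≡-Reasoning
    h : ℕ → Bool
    h r = ⌊ r mod g ≟ i ⌋
    onePeriod : countBelow g h ≡ 1
    onePeriod = trans (countBelow-cong g (λ r r<g → trans (⌊mod≟⌋ r) (cong (λ x → ⌊ x ℕ.≟ toℕ i ⌋) (m<n⇒m%n≡m r<g))))
                      (countBelow-≟ g (toℕ i) (toℕ<n i))
    periodic : ∀ r → h (g + r) ≡ h r
    periodic r = begin
      h (g + r)                        ≡⟨ ⌊mod≟⌋ (g + r) ⟩
      ⌊ (g + r) % g ℕ.≟ toℕ i ⌋        ≡⟨ cong (λ x → ⌊ x % g ℕ.≟ toℕ i ⌋) (+-comm g r) ⟩
      ⌊ (r + g) % g ℕ.≟ toℕ i ⌋        ≡⟨ cong (λ x → ⌊ x ℕ.≟ toℕ i ⌋) ([m+n]%n≡m%n r g) ⟩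
      ⌊ r % g ℕ.≟ toℕ i ⌋              ≡⟨ ⌊mod≟⌋ r ⟨
      h r                              ∎

_≟ℓ_ : ∀ {p θ} → DecidableEquality (PartLabel p θ)
_≟ℓ_ = ≡-dec _≟_ _≟_

partEqᵇ≡⌊≟⌋ : ∀ {p θ} (ℓ ℓ′ : PartLabel p θ) → partEqᵇ ℓ ℓ′ ≡ ⌊ ℓ ≟ℓ ℓ′ ⌋
partEqᵇ≡⌊≟⌋ (i , j) (i′ , j′) with i ≟ i′
... | yes refl = sym (⌊⌋-map′ _ _ (j ≟ j′))
... | no _ = refl

∑ˡ : ∀ {p} {θ : Fin p → ℕ} → (PartLabel p θ → ℕ) → ℕ
∑ˡ {p} {θ} f = ∑[ a < p ] ∑[ b < θ a ] f (a , b)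

module _ {p} {θ : Fin p → ℕ} where

  ∑ˡ-cong : {f g : PartLabel p θ → ℕ} → (∀ ℓ → f ℓ ≡ g ℓ) → ∑ˡ f ≡ ∑ˡ g
  ∑ˡ-cong f≗g = sum-cong-≗ (λ a → sum-cong-≗ (λ b → f≗g (a , b)))

  ∑ˡ-mono-≤ : {f g : PartLabel p θ → ℕ} → (∀ ℓ → f ℓ ≤ g ℓ) → ∑ˡ f ≤ ∑ˡ g
  ∑ˡ-mono-≤ f≤g = ∑-mono-≤ (λ a → ∑-mono-≤ (λ b → f≤g (a , b)))

  ∑ˡ-distrib-+ : (f g : PartLabel p θ → ℕ) → ∑ˡ (λ ℓ → f ℓ + g ℓ) ≡ ∑ˡ f + ∑ˡ g
  ∑ˡ-distrib-+ f g = trans (sum-cong-≗ (λ a → ∑-distrib-+ (λ b → f (a , b)) (λ b → g (a , b))))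
    (∑-distrib-+ (λ a → ∑[ b < θ a ] f (a , b)) (λ a → ∑[ b < θ a ] g (a , b)))

  ∑ˡ-const : ∀ x → ∑ˡ {p} {θ} (λ _ → x) ≡ (∑[ a < p ] θ a) * x
  ∑ˡ-const x = trans (sum-cong-≗ (λ a → ∑-const (θ a) x)) (sym (*-distribʳ-sum x θ))

  ∑-𝟙-partEqᵇ : ∀ (ℓ : PartLabel p θ) a → ∑[ b < θ a ] 𝟙 (partEqᵇ ℓ (a , b)) ≡ 𝟙 ⌊ proj₁ ℓ ≟ a ⌋
  ∑-𝟙-partEqᵇ (i , j) a with i ≟ a
  ... | yes refl = ∑-𝟙-≟ j
  ... | no _ = sum-replicate-zero (θ a)

  ∑ˡ-𝟙-partEqᵇ : ∀ (ℓ : PartLabel p θ) → ∑ˡ (λ ℓ′ → 𝟙 (partEqᵇ ℓ ℓ′)) ≡ 1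
  ∑ˡ-𝟙-partEqᵇ ℓ = trans (sum-cong-≗ (∑-𝟙-partEqᵇ ℓ)) (∑-𝟙-≟ (proj₁ ℓ))

  ∑ˡ-𝟙-∧-partEqᵇ : ∀ q (ℓ : PartLabel p θ) → ∑ˡ (λ ℓ′ → 𝟙 (q ∧ partEqᵇ ℓ ℓ′)) ≡ 𝟙 q
  ∑ˡ-𝟙-∧-partEqᵇ false ℓ = trans (∑ˡ-const 0) (*-zeroʳ (∑[ a < p ] θ a))
  ∑ˡ-𝟙-∧-partEqᵇ true ℓ = ∑ˡ-𝟙-partEqᵇ ℓ

  2≤#parts : ∀ {ℓ₁ ℓ₂ : PartLabel p θ} → ℓ₁ ≢ ℓ₂ → 2 ≤ ∑[ a < p ] θ a
  2≤#parts {ℓ₁} {ℓ₂} ℓ₁≢ℓ₂ = begin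
    2
      ≡⟨ cong₂ _+_ (∑ˡ-𝟙-partEqᵇ ℓ₁) (∑ˡ-𝟙-partEqᵇ ℓ₂) ⟨
    ∑ˡ (𝟙 ∘ partEqᵇ ℓ₁) + ∑ˡ (𝟙 ∘ partEqᵇ ℓ₂)
      ≡⟨ ∑ˡ-distrib-+ (𝟙 ∘ partEqᵇ ℓ₁) (𝟙 ∘ partEqᵇ ℓ₂) ⟨
    ∑ˡ (λ ℓ → 𝟙 (partEqᵇ ℓ₁ ℓ) + 𝟙 (partEqᵇ ℓ₂ ℓ))
      ≤⟨ ∑ˡ-mono-≤ atMostOne ⟩
    ∑ˡ {θ = θ} (λ _ → 1)
      ≡⟨ ∑ˡ-const 1 ⟩
    (∑[ a < p ] θ a) * 1
      ≡⟨ *-identityʳ _ ⟩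
    ∑[ a < p ] θ a ∎
    where
    open ≤-Reasoning
    atMostOne : ∀ ℓ → 𝟙 (partEqᵇ ℓ₁ ℓ) + 𝟙 (partEqᵇ ℓ₂ ℓ) ≤ 1
    atMostOne ℓ rewrite partEqᵇ≡⌊≟⌋ ℓ₁ ℓ | partEqᵇ≡⌊≟⌋ ℓ₂ ℓ with ℓ₁ ≟ℓ ℓ | ℓ₂ ≟ℓ ℓ
    ... | yes refl | yes refl = contradiction refl ℓ₁≢ℓ₂
    ... | yes _ | no _ = s≤s z≤n
    ... | no _ | yes _ = s≤s z≤n
    ... | no _ | no _ = z≤n

-- Complete multipartite graphs

module CompleteMultipartite {N p} {n θ : Fin p → ℕ} {G : Graph N} {part : Fin N → PartLabel p θ}
  (multipartite : IsCompleteMultipartite p n θ G part) (n>0 : ∀ a → 0 < n a) (θ>0 : ∀ a → 0 < θ a) where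

  group : Fin N → Fin p
  group v = proj₁ (part v)

  inPart : PartLabel p θ → Fin N → Bool
  inPart ℓ w = partEqᵇ (part w) ℓ

  inPart-sound : ∀ {ℓ w} → inPart ℓ w ≡ true → part w ≡ ℓ
  inPart-sound {ℓ} {w} w∈ℓ = ⌊⌋-sound (part w ≟ℓ ℓ) (trans (sym (partEqᵇ≡⌊≟⌋ (part w) ℓ)) w∈ℓ)

  partSize : ∀ ℓ → count (inPart ℓ) ≡ n (proj₁ ℓ)
  partSize (a , b) = proj₁ multipartite a b

  representative : ∀ ℓ → ∃ λ v → part v ≡ ℓ
  representative ℓ with count-witness (inPart ℓ) (subst (0 <_) (sym (partSize ℓ)) (n>0 (proj₁ ℓ)))
  ... | v , v∈ℓ = v , inPart-sound v∈ℓ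

  groupRep : Fin p → Fin N
  groupRep a = proj₁ (representative (a , fromℕ< (θ>0 a)))

  group-groupRep : ∀ a → group (groupRep a) ≡ a
  group-groupRep a = cong proj₁ (proj₂ (representative (a , fromℕ< (θ>0 a))))

  adj-different : ∀ {v w} → part v ≢ part w → adj G v w ≡ true
  adj-different {v} {w} = proj₂ (proj₂ multipartite v w)

  adj≡not-inPart : ∀ v w → adj G v w ≡ not (inPart (part v) w)
  adj≡not-inPart v w rewrite partEqᵇ≡⌊≟⌋ (part w) (part v) with part w ≟ℓ part v
  ... | yes w∼v = ¬-not (λ adjacent → proj₁ (proj₂ multipartite v w) adjacent (sym w∼v))
  ... | no w≁v = adj-different (w≁v ∘ sym)

  adj-cong : ∀ {u w} → part u ≡ part w → ∀ y → adj G u y ≡ adj G w y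
  adj-cong {u} {w} u∼w y = begin
    adj G u y                ≡⟨ adj≡not-inPart u y ⟩
    not (inPart (part u) y)  ≡⟨ cong (λ ℓ → not (inPart ℓ y)) u∼w ⟩
    not (inPart (part w) y)  ≡⟨ adj≡not-inPart w y ⟨
    adj G w y                ∎
    where open ≡-Reasoning

  deg-cong : ∀ {u w} → part u ≡ part w → deg G u ≡ deg G w
  deg-cong u∼w = count-cong (adj-cong u∼w)

  eClass-cong : ∀ {k} (c : Fin N → Fin k) {u w} → part u ≡ part w → ∀ i → eClass G c u i ≡ eClass G c w i
  eClass-cong c u∼w i = count-cong (λ y → cong (_∧ ⌊ c y ≟ i ⌋) (adj-cong u∼w y))

  partSize+deg : ∀ v → n (group v) + deg G v ≡ N
  partSize+deg v = begin
    n (group v) + deg G v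
      ≡⟨ cong₂ _+_ (partSize (part v)) (sym (count-cong (adj≡not-inPart v))) ⟨
    count (inPart (part v)) + count (not ∘ inPart (part v))
      ≡⟨ count-complement (inPart (part v)) ⟩
    N ∎
    where open ≡-Reasoning

  deg-pos : ∀ {u₀ w₀} → part u₀ ≢ part w₀ → ∀ v → 0 < deg G v
  deg-pos {u₀} {w₀} u₀≁w₀ v with part u₀ ≟ℓ part v
  ... | yes u₀∼v = count-pos (adj G v) w₀ (adj-different (λ v∼w₀ → u₀≁w₀ (trans u₀∼v v∼w₀)))
  ... | no u₀≁v = count-pos (adj G v) u₀ (adj-different (u₀≁v ∘ sym))

  count-byParts : ∀ Q → count Q ≡ ∑ˡ (λ ℓ → count (λ w → Q w ∧ inPart ℓ w))
  count-byParts Q = begin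
    count Q
      ≡⟨ count≡∑ Q ⟩
    ∑[ w < N ] 𝟙 (Q w)
      ≡⟨ sum-cong-≗ (λ w → ∑ˡ-𝟙-∧-partEqᵇ (Q w) (part w)) ⟨
    ∑[ w < N ] ∑[ a < p ] ∑[ b < θ a ] 𝟙 (Q w ∧ inPart (a , b) w)
      ≡⟨ ∑-comm (λ w a → ∑[ b < θ a ] 𝟙 (Q w ∧ inPart (a , b) w)) ⟩
    ∑[ a < p ] ∑[ w < N ] ∑[ b < θ a ] 𝟙 (Q w ∧ inPart (a , b) w)
      ≡⟨ sum-cong-≗ (λ a → ∑-comm (λ w b → 𝟙 (Q w ∧ inPart (a , b) w))) ⟩
    ∑[ a < p ] ∑[ b < θ a ] ∑[ w < N ] 𝟙 (Q w ∧ inPart (a , b) w)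
      ≡⟨ ∑ˡ-cong (λ ℓ → count≡∑ (λ w → Q w ∧ inPart ℓ w)) ⟨
    ∑ˡ (λ ℓ → count (λ w → Q w ∧ inPart ℓ w)) ∎
    where open ≡-Reasoning

  groupSize : ∀ a → count (λ w → ⌊ group w ≟ a ⌋) ≡ θ a * n a
  groupSize a = begin
    count (λ w → ⌊ group w ≟ a ⌋)
      ≡⟨ count≡∑ (λ w → ⌊ group w ≟ a ⌋) ⟩
    ∑[ w < N ] 𝟙 ⌊ group w ≟ a ⌋
      ≡⟨ sum-cong-≗ (λ w → ∑-𝟙-partEqᵇ (part w) a) ⟨
    ∑[ w < N ] ∑[ b < θ a ] 𝟙 (inPart (a , b) w)
      ≡⟨ ∑-comm (λ w b → 𝟙 (inPart (a , b) w)) ⟩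
    ∑[ b < θ a ] ∑[ w < N ] 𝟙 (inPart (a , b) w)
      ≡⟨ sum-cong-≗ (λ b → trans (sym (count≡∑ (inPart (a , b)))) (partSize (a , b))) ⟩
    ∑[ b < θ a ] n a
      ≡⟨ ∑-const (θ a) (n a) ⟩
    θ a * n a ∎
    where open ≡-Reasoning

  module Colouring {k} (c : Fin N → Fin k) where

    colourCount : Fin k → ℕ
    colourCount i = count (λ w → ⌊ c w ≟ i ⌋)

    partColourCount : PartLabel p θ → Fin k → ℕ
    partColourCount ℓ i = count (λ w → inPart ℓ w ∧ ⌊ c w ≟ i ⌋)

    partColourCount+eClass : ∀ v i → partColourCount (part v) i + eClass G c v i ≡ colourCount i
    partColourCount+eClass v i = sym (trans (count-split (inPart (part v)) (λ w → ⌊ c w ≟ i ⌋))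
      (cong (partColourCount (part v) i +_) (count-cong (λ w → cong (_∧ ⌊ c w ≟ i ⌋) (sym (adj≡not-inPart v w))))))

    colourCount≡∑ˡ : ∀ i → colourCount i ≡ ∑ˡ (λ ℓ → partColourCount ℓ i)
    colourCount≡∑ˡ i = trans (count-byParts _) (∑ˡ-cong (λ ℓ → count-cong (λ w → ∧-comm ⌊ c w ≟ i ⌋ (inPart ℓ w))))

    partSize≡∑ : ∀ ℓ → n (proj₁ ℓ) ≡ ∑[ i < k ] partColourCount ℓ i
    partSize≡∑ ℓ = trans (sym (partSize ℓ)) (count-partition c (inPart ℓ))

    PartwiseConstant : Set
    PartwiseConstant = ∀ u w → part u ≡ part w → c u ≡ c w

    partwiseConstant? : PartwiseConstant ⊎ (∃₂ λ u w → part u ≡ part w × c u ≢ c w)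
    partwiseConstant? with any? (λ u → any? (λ w → (part u ≟ℓ part w) ×-dec ¬? (c u ≟ c w)))
    ... | yes (u , w , u∼w , cu≢cw) = inj₂ (u , w , u∼w , cu≢cw)
    ... | no noSplitPart = inj₁ λ u w u∼w → decidable-stable (c u ≟ c w) (λ cu≢cw → noSplitPart (u , w , u∼w , cu≢cw))

    eClass-partwiseConstant : PartwiseConstant → ∀ v i → c v ≢ i → eClass G c v i ≡ colourCount i
    eClass-partwiseConstant constant v i cv≢i = begin
      eClass G c v i                                   ≡⟨ cong (_+ eClass G c v i) noneInPart ⟨
      partColourCount (part v) i + eClass G c v i      ≡⟨ partColourCount+eClass v i ⟩
      colourCount i                                    ∎
      where
      open ≡-Reasoning
      noneInPart : partColourCount (part v) i ≡ 0
      noneInPart = count-none _ λ w → notColour-i w (inPart (part v) w) refl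
        where
        notColour-i : ∀ w b → inPart (part v) w ≡ b → b ∧ ⌊ c w ≟ i ⌋ ≡ false
        notColour-i w false _ = refl
        notColour-i w true w∈v = ⌊⌋-no (c w ≟ i) (cv≢i ∘ trans (constant v w (sym (inPart-sound w∈v))))

  module FATColouring {k} {c : Fin N → Fin k} (fat : IsFATColoring G k c) where

    open Colouring c

    α β : ℚ
    α = proj₁ (proj₂ fat)
    β = 1ℚ ℚ.- ℕtoℚ (k ∸ 1) ℚ.* α

    offDiagonal : ∀ v i → c v ≢ i → ℕtoℚ (eClass G c v i) ≡ α ℚ.* ℕtoℚ (deg G v)
    offDiagonal v i = proj₁ (proj₂ (proj₂ (proj₂ (proj₂ fat))) v i)

    diagonal : ∀ v → ℕtoℚ (eClass G c v (c v)) ≡ β ℚ.* ℕtoℚ (deg G v)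
    diagonal v = proj₂ (proj₂ (proj₂ (proj₂ (proj₂ fat))) v (c v)) refl

    colourCount-pos : ∀ i → 0 < colourCount i
    colourCount-pos i = let (v , cv≡i) = proj₁ fat i in count-pos _ v (⌊⌋-yes (c v ≟ i) cv≡i)

    module SplitPart {u w u₀ w₀} (u∼w : part u ≡ part w) (cu≢cw : c u ≢ c w) (u₀≁w₀ : part u₀ ≢ part w₀) where

      eClass-off≡own : ∀ v i → c v ≢ i → eClass G c v i ≡ eClass G c v (c v)
      eClass-off≡own v i cv≢i = *-cancelʳ-≡ _ _ (deg G u) {{>-nonZero (deg-pos u₀≁w₀ u)}} (begin
        eClass G c v i * deg G u
          ≡⟨ ℕtoℚ-cross α (eClass G c v i) (deg G v) (eClass G c u (c w)) (deg G u) (offDiagonal v i cv≢i) (offDiagonal u (c w) cu≢cw) ⟩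
        eClass G c u (c w) * deg G v
          ≡⟨ cong (_* deg G v) (eClass-cong c u∼w (c w)) ⟩
        eClass G c w (c w) * deg G v
          ≡⟨ ℕtoℚ-cross β (eClass G c w (c w)) (deg G w) (eClass G c v (c v)) (deg G v) (diagonal w) (diagonal v) ⟩
        eClass G c v (c v) * deg G w
          ≡⟨ cong (eClass G c v (c v) *_) (deg-cong u∼w) ⟨
        eClass G c v (c v) * deg G u ∎)
        where open ≡-Reasoning

      eClass≡own : ∀ v i → eClass G c v i ≡ eClass G c v (c v)
      eClass≡own v i = [ (λ cv≡i → cong (eClass G c v) (sym cv≡i)) , eClass-off≡own v i ]′ (toSum (c v ≟ i))

      eClass-const : ∀ v i j → eClass G c v i ≡ eClass G c v j
      eClass-const v i j = trans (eClass≡own v i) (sym (eClass≡own v j))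

      partColourCount-shift : ∀ v i j → partColourCount (part v) i + colourCount j ≡ partColourCount (part v) j + colourCount i
      partColourCount-shift v i j = begin
        partColourCount (part v) i + colourCount j
          ≡⟨ cong (partColourCount (part v) i +_) (partColourCount+eClass v j) ⟨
        partColourCount (part v) i + (partColourCount (part v) j + eClass G c v j)
          ≡⟨ x∙yz≈y∙xz (partColourCount (part v) i) (partColourCount (part v) j) (eClass G c v j) ⟩
        partColourCount (part v) j + (partColourCount (part v) i + eClass G c v j)
          ≡⟨ cong (λ e → partColourCount (part v) j + (partColourCount (part v) i + e)) (eClass-const v j i) ⟩
        partColourCount (part v) j + (partColourCount (part v) i + eClass G c v i)
          ≡⟨ cong (partColourCount (part v) j +_) (partColourCount+eClass v i) ⟩
        partColourCount (part v) j + colourCount i ∎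
        where open ≡-Reasoning

      colourCount-const : ∀ i j → colourCount i ≡ colourCount j
      colourCount-const i j = a+m*b≡b+m*a⇒a≡b (colourCount i) (colourCount j) (2≤#parts u₀≁w₀) (begin
        colourCount i + m * colourCount j
          ≡⟨ cong₂ _+_ (colourCount≡∑ˡ i) (sym (∑ˡ-const {θ = θ} (colourCount j))) ⟩
        ∑ˡ (λ ℓ → partColourCount ℓ i) + ∑ˡ {θ = θ} (λ _ → colourCount j)
          ≡⟨ ∑ˡ-distrib-+ (λ ℓ → partColourCount ℓ i) (λ _ → colourCount j) ⟨
        ∑ˡ (λ ℓ → partColourCount ℓ i + colourCount j)
          ≡⟨ ∑ˡ-cong shift ⟩
        ∑ˡ (λ ℓ → partColourCount ℓ j + colourCount i)
          ≡⟨ ∑ˡ-distrib-+ (λ ℓ → partColourCount ℓ j) (λ _ → colourCount i) ⟩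
        ∑ˡ (λ ℓ → partColourCount ℓ j) + ∑ˡ {θ = θ} (λ _ → colourCount i)
          ≡⟨ cong₂ _+_ (colourCount≡∑ˡ j) (sym (∑ˡ-const {θ = θ} (colourCount i))) ⟨
        colourCount j + m * colourCount i ∎)
        where
        open ≡-Reasoning
        m = ∑[ a < p ] θ a
        shift : ∀ ℓ → partColourCount ℓ i + colourCount j ≡ partColourCount ℓ j + colourCount i
        shift ℓ = let (v , v∈ℓ) = representative ℓ in
          subst (λ ℓ → partColourCount ℓ i + colourCount j ≡ partColourCount ℓ j + colourCount i) v∈ℓ (partColourCount-shift v i j)

      partColourCount-const : ∀ v i j → partColourCount (part v) i ≡ partColourCount (part v) j
      partColourCount-const v i j = +-cancelʳ-≡ (eClass G c v i) _ _ (begin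
        partColourCount (part v) i + eClass G c v i
          ≡⟨ partColourCount+eClass v i ⟩
        colourCount i
          ≡⟨ colourCount-const i j ⟩
        colourCount j
          ≡⟨ partColourCount+eClass v j ⟨
        partColourCount (part v) j + eClass G c v j
          ≡⟨ cong (partColourCount (part v) j +_) (eClass-const v j i) ⟩
        partColourCount (part v) j + eClass G c v i ∎)
        where open ≡-Reasoning

      ∣partSize : ∀ a → k ∣ n a
      ∣partSize a = divides (partColourCount ℓ (c u)) (begin
        n a
          ≡⟨ cong n (group-groupRep a) ⟨
        n (group v)
          ≡⟨ partSize≡∑ ℓ ⟩
        ∑[ i < k ] partColourCount ℓ i
          ≡⟨ sum-cong-≗ (λ i → partColourCount-const v i (c u)) ⟩
        ∑[ i < k ] partColourCount ℓ (c u)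
          ≡⟨ ∑-const k (partColourCount ℓ (c u)) ⟩
        k * partColourCount ℓ (c u)
          ≡⟨ *-comm k (partColourCount ℓ (c u)) ⟩
        partColourCount ℓ (c u) * k ∎)
        where
        open ≡-Reasoning
        v = groupRep a
        ℓ = part v

    partSize-avoiding : PartwiseConstant → ∀ {v w i} → c v ≢ i → c w ≢ i → n (group v) ≡ n (group w)
    partSize-avoiding constant {v} {w} {i} cv≢i cw≢i = +-cancelʳ-≡ (deg G v) _ _ (begin
      n (group v) + deg G v ≡⟨ partSize+deg v ⟩
      N                     ≡⟨ partSize+deg w ⟨
      n (group w) + deg G w ≡⟨ cong (n (group w) +_) deg-w≡deg-v ⟩
      n (group w) + deg G v ∎)
      where
      open ≡-Reasoning
      sees-class : ∀ x → c x ≢ i → ℕtoℚ (colourCount i) ≡ α ℚ.* ℕtoℚ (deg G x)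
      sees-class x cx≢i = trans (cong ℕtoℚ (sym (eClass-partwiseConstant constant x i cx≢i))) (offDiagonal x i cx≢i)
      deg-w≡deg-v : deg G w ≡ deg G v
      deg-w≡deg-v = *-cancelˡ-≡ _ _ (colourCount i) {{>-nonZero (colourCount-pos i)}}
        (ℕtoℚ-cross α (colourCount i) (deg G v) (colourCount i) (deg G w) (sees-class v cv≢i) (sees-class w cw≢i))

  open Colouring using (PartwiseConstant)

  sameColour⇒sameSize : ∀ {k} {c : Fin N → Fin (2 + k)} → IsFATColoring G (2 + k) c → PartwiseConstant c →
    ∀ {v w} → c v ≡ c w → n (group v) ≡ n (group w)
  sameColour⇒sameSize {c = c} fat constant {v} cv≡cw = let (i , cv≢i) = avoid₁ (c v) in
    FATColouring.partSize-avoiding fat constant cv≢i (cv≢i ∘ trans cv≡cw)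

  threeColours⇒sameSize : ∀ {k} {c : Fin N → Fin (3 + k)} → IsFATColoring G (3 + k) c → PartwiseConstant c →
    ∀ v w → n (group v) ≡ n (group w)
  threeColours⇒sameSize {c = c} fat constant v w = let (i , cv≢i , cw≢i) = avoid₂ (c v) (c w) in
    FATColouring.partSize-avoiding fat constant cv≢i cw≢i

  #groups≤#colours : ∀ {k} {c : Fin N → Fin (2 + k)} → IsFATColoring G (2 + k) c → PartwiseConstant c →
    (∀ {a b} → n a ≡ n b → a ≡ b) → p ≤ 2 + k
  #groups≤#colours {c = c} fat constant n-injective = injective⇒≤ {f = c ∘ groupRep} λ {a} {b} same →
    trans (sym (group-groupRep a)) (trans (n-injective (sameColour⇒sameSize fat constant same)) (group-groupRep b))

  module RankColouring (g : ℕ) .{{_ : NonZero g}} (g∣n : ∀ a → g ∣ n a) where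

    open Colouring

    colouring : Fin N → Fin g
    colouring w = rank (inPart (part w)) w mod g

    quotient : PartLabel p θ → ℕ
    quotient ℓ = _∣_.quotient (g∣n (proj₁ ℓ))

    partColourCount≡quotient : ∀ ℓ i → partColourCount colouring ℓ i ≡ quotient ℓ
    partColourCount≡quotient ℓ i = begin
      partColourCount colouring ℓ i
        ≡⟨ count-cong rankIn-ℓ ⟩
      count (λ w → inPart ℓ w ∧ h (rank (inPart ℓ) w))
        ≡⟨ count-rank (inPart ℓ) h ⟩
      countBelow (count (inPart ℓ)) h
        ≡⟨ cong (λ m → countBelow m h) (trans (partSize ℓ) (_∣_.equality (g∣n (proj₁ ℓ)))) ⟩
      countBelow (quotient ℓ * g) h
        ≡⟨ countBelow-mod g i (quotient ℓ) ⟩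
      quotient ℓ ∎
      where
      open ≡-Reasoning
      h : ℕ → Bool
      h r = ⌊ r mod g ≟ i ⌋
      rankIn-ℓ : ∀ w → inPart ℓ w ∧ ⌊ colouring w ≟ i ⌋ ≡ inPart ℓ w ∧ h (rank (inPart ℓ) w)
      rankIn-ℓ w with inPart ℓ w in w∈ℓ
      ... | false = refl
      ... | true = cong (λ ℓ′ → h (rank (inPart ℓ′) w)) (inPart-sound w∈ℓ)

    eClass-const : ∀ v i j → eClass G colouring v i ≡ eClass G colouring v j
    eClass-const v i j = +-cancelˡ-≡ (quotient (part v)) _ _ (begin
      quotient (part v) + eClass G colouring v i
        ≡⟨ cong (_+ eClass G colouring v i) (partColourCount≡quotient (part v) i) ⟨
      partColourCount colouring (part v) i + eClass G colouring v i
        ≡⟨ partColourCount+eClass colouring v i ⟩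
      colourCount colouring i
        ≡⟨ colourCount≡∑ˡ colouring i ⟩
      ∑ˡ (λ ℓ → partColourCount colouring ℓ i)
        ≡⟨ ∑ˡ-cong (λ ℓ → trans (partColourCount≡quotient ℓ i) (sym (partColourCount≡quotient ℓ j))) ⟩
      ∑ˡ (λ ℓ → partColourCount colouring ℓ j)
        ≡⟨ colourCount≡∑ˡ colouring j ⟨
      colourCount colouring j
        ≡⟨ partColourCount+eClass colouring v j ⟨
      partColourCount colouring (part v) j + eClass G colouring v j
        ≡⟨ cong (_+ eClass G colouring v j) (partColourCount≡quotient (part v) j) ⟩
      quotient (part v) + eClass G colouring v j ∎)
      where open ≡-Reasoning

    surjective : Fin N → ∀ i → ∃ λ w → colouring w ≡ i
    surjective v₀ i with count-witness (λ w → inPart (part v₀) w ∧ ⌊ colouring w ≟ i ⌋)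
                                       (subst (0 <_) (sym (partColourCount≡quotient (part v₀) i)) quotient>0)
      where
      quotient>0 : 0 < quotient (part v₀)
      quotient>0 with quotient (part v₀) in q≡ | n>0 (group v₀)
      ... | zero | n>0 = contradiction (trans (_∣_.equality (g∣n (group v₀))) (cong (_* g) q≡)) (<⇒≢ n>0 ∘ sym)
      ... | suc _ | _ = s≤s z≤n
    ... | w , w∈v₀∧i = w , ⌊⌋-sound (colouring w ≟ i) (∧-conicalʳ _ _ w∈v₀∧i)

    isFAT : Fin N → IsFATColoring G g colouring
    isFAT v₀ = isFATColoring-byRatio G colouring (surjective v₀) 1 g (>-nonZero⁻¹ g) λ v →
      let e = eClass G colouring v (colouring v) in
      e , (λ i _ → eClass-const v i (colouring v)) , (begin
        e * g
          ≡⟨ *-comm e g ⟩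
        g * e
          ≡⟨ ∑-const g e ⟨
        ∑[ i < g ] e
          ≡⟨ sum-cong-≗ (λ i → eClass-const v i (colouring v)) ⟨
        ∑[ i < g ] eClass G colouring v i
          ≡⟨ deg≡∑eClass G colouring v ⟨
        deg G v
          ≡⟨ +-identityʳ (deg G v) ⟨
        1 * deg G v ∎)
      where open ≡-Reasoning

  hasFAT-gcd : .{{_ : NonZero (gcdAll n)}} → Fin N → HasFATColoring G (gcdAll n)
  hasFAT-gcd v₀ = RankColouring.colouring (gcdAll n) (gcdAll-∣ n) , RankColouring.isFAT (gcdAll n) (gcdAll-∣ n) v₀

  splitPart⇒≤gcd : .{{_ : NonZero (gcdAll n)}} → ∀ {k} {c : Fin N → Fin k} → IsFATColoring G k c →
    ∀ {u₀ w₀} → part u₀ ≢ part w₀ → (∃₂ λ u w → part u ≡ part w × c u ≢ c w) → k ≤ gcdAll n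
  splitPart⇒≤gcd fat u₀≁w₀ (u , w , u∼w , cu≢cw) =
    ∣⇒≤ (gcdAll-greatest n (FATColouring.SplitPart.∣partSize fat u∼w cu≢cw u₀≁w₀))

-- The three cases of the theorem

module AtLeastTwoGroups {N p} {n θ : Fin (2 + p) → ℕ} {G : Graph N} {part : Fin N → PartLabel (2 + p) θ}
  (multipartite : IsCompleteMultipartite (2 + p) n θ G part)
  (n>0 : ∀ a → 0 < n a) (θ>0 : ∀ a → 0 < θ a) (increasing : ∀ a b → b Fin.< a → n b < n a) where

  open CompleteMultipartite {N} {2 + p} {n} {θ} {G} {part} multipartite n>0 θ>0 public
  open Colouring using (PartwiseConstant; partwiseConstant?) public

  instance
    gcd≢0 : NonZero (gcdAll n)
    gcd≢0 = >-nonZero (gcdAll-pos n (n>0 zero))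

  r₀ r₁ : Fin N
  r₀ = groupRep zero
  r₁ = groupRep (suc zero)

  n-injective : ∀ {a b} → n a ≡ n b → a ≡ b
  n-injective = strictlyIncreasing⇒injective increasing

  group-groupRep-injective : ∀ {a b} → group (groupRep a) ≡ group (groupRep b) → a ≡ b
  group-groupRep-injective {a} {b} same = trans (sym (group-groupRep a)) (trans same (group-groupRep b))

  r₀≁r₁ : part r₀ ≢ part r₁
  r₀≁r₁ same = contradiction (group-groupRep-injective (cong proj₁ same)) λ ()

  partwiseConstant⇒≤2 : ∀ {k} {c : Fin N → Fin k} → IsFATColoring G k c → PartwiseConstant c → k ≤ 2
  partwiseConstant⇒≤2 {zero} _ _ = z≤n
  partwiseConstant⇒≤2 {suc zero} _ _ = s≤s z≤n
  partwiseConstant⇒≤2 {suc (suc zero)} _ _ = ≤-refl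
  partwiseConstant⇒≤2 {suc (suc (suc k))} fat constant =
    contradiction (group-groupRep-injective (n-injective (threeColours⇒sameSize fat constant r₀ r₁))) λ ()

module OneGroup {N} {n θ : Fin 1 → ℕ} {G : Graph N} {part : Fin N → PartLabel 1 θ}
  (multipartite : IsCompleteMultipartite 1 n θ G part) (n>0 : ∀ a → 0 < n a) (θ>0 : ∀ a → 0 < θ a) where

  open CompleteMultipartite {N} {1} {n} {θ} {G} {part} multipartite n>0 θ>0
  open Colouring using (colourCount; PartwiseConstant; partwiseConstant?; eClass-partwiseConstant)

  index : PartLabel 1 θ → Fin (θ zero)
  index (zero , j) = j

  label-index : ∀ ℓ → (zero , index ℓ) ≡ ℓ
  label-index (zero , j) = refl

  n-group : ∀ v → n (group v) ≡ n zero
  n-group v with group v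
  ... | zero = refl

  N≡θn : N ≡ θ zero * n zero
  N≡θn = trans (sym (count-all _ (λ w → ⌊⌋-yes (group w ≟ zero) (only (group w))))) (groupSize zero)
    where
    only : (a : Fin 1) → a ≡ zero
    only zero = refl

  gcd≡n : gcdAll n ≡ n zero
  gcd≡n = gcd-identityʳ (n zero)

  instance
    gcd≢0 : NonZero (gcdAll n)
    gcd≢0 = >-nonZero (gcdAll-pos n (n>0 zero))

  partColouring : Fin N → Fin (θ zero)
  partColouring w = index (part w)

  partColouring-isFAT : 1 < θ zero → IsFATColoring G (θ zero) partColouring
  partColouring-isFAT 1<θ =
    isFATColoring-byRatio G partColouring surjective 1 t {{>-nonZero t>0}} t>0 λ v → n zero , others v , ratio-eq v
    where
    t = θ zero ∸ 1
    θ≡1+t : θ zero ≡ suc t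
    θ≡1+t = sym (suc[m∸1]≡m (θ>0 zero))
    t>0 : 0 < t
    t>0 = ≤-pred (subst (1 <_) θ≡1+t 1<θ)
    surjective : ∀ j → ∃ λ v → partColouring v ≡ j
    surjective j with representative (zero , j)
    ... | v , v∈j = v , cong index v∈j
    classSize : ∀ j → colourCount partColouring j ≡ n zero
    classSize j = trans (count-cong (λ w → ⌊index≟⌋ (part w))) (partSize (zero , j))
      where
      ⌊index≟⌋ : ∀ ℓ → ⌊ index ℓ ≟ j ⌋ ≡ partEqᵇ ℓ (zero , j)
      ⌊index≟⌋ (zero , _) = refl
    others : ∀ v i → partColouring v ≢ i → eClass G partColouring v i ≡ n zero
    others v i cv≢i = trans (eClass-partwiseConstant partColouring (λ _ _ → cong index) v i cv≢i) (classSize i)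
    ratio-eq : ∀ v → n zero * t ≡ 1 * deg G v
    ratio-eq v = +-cancelˡ-≡ (n zero) _ _ (begin
      n zero + n zero * t      ≡⟨ cong (n zero +_) (*-comm (n zero) t) ⟩
      suc t * n zero           ≡⟨ cong (_* n zero) θ≡1+t ⟨
      θ zero * n zero          ≡⟨ N≡θn ⟨
      N                        ≡⟨ partSize+deg v ⟨
      n (group v) + deg G v    ≡⟨ cong₂ _+_ (n-group v) (sym (+-identityʳ (deg G v))) ⟩
      n zero + 1 * deg G v     ∎)
      where open ≡-Reasoning

  partwiseConstant⇒≤θ : ∀ {k} {c : Fin N → Fin k} → IsFATColoring G k c → PartwiseConstant c → k ≤ θ zero
  partwiseConstant⇒≤θ {k} {c} fat constant = surjective⇒≤ c′ λ i →
    let (v , cv≡i) = proj₁ fat i in index (part v) , trans (constant _ v (rep∼ v)) cv≡i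
    where
    rep : ∀ j → ∃ λ v → part v ≡ (zero , j)
    rep j = representative (zero , j)
    rep∼ : ∀ v → part (proj₁ (rep (index (part v)))) ≡ part v
    rep∼ v = trans (proj₂ (rep (index (part v)))) (label-index (part v))
    c′ : Fin (θ zero) → Fin k
    c′ j = c (proj₁ (rep j))

  rep₀ : Fin N
  rep₀ = proj₁ (representative (zero , fromℕ< (θ>0 zero)))

  rep₁ : 1 < θ zero → Fin N
  rep₁ 1<θ = proj₁ (representative (zero , fromℕ< 1<θ))

  rep₀≁rep₁ : ∀ 1<θ → part rep₀ ≢ part (rep₁ 1<θ)
  rep₀≁rep₁ 1<θ same = contradiction (begin
    0
      ≡⟨ toℕ-fromℕ< (θ>0 zero) ⟨
    toℕ (index (zero , fromℕ< (θ>0 zero)))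
      ≡⟨ cong (toℕ ∘ index) (trans (sym (proj₂ (representative _))) (trans same (proj₂ (representative _)))) ⟩
    toℕ (index (zero , fromℕ< 1<θ))
      ≡⟨ toℕ-fromℕ< 1<θ ⟩
    1 ∎) λ ()
    where open ≡-Reasoning

  θ≡1 : ¬ 1 < θ zero → θ zero ≡ 1
  θ≡1 1≮θ = ≤-antisym (≮⇒≥ 1≮θ) (θ>0 zero)

  splitPart⇒≤n : ∀ {k} {c : Fin N → Fin k} → IsFATColoring G k c → (∃₂ λ u w → part u ≡ part w × c u ≢ c w) → k ≤ n zero
  splitPart⇒≤n {c = c} fat split =
    [ (λ 1<θ → subst (_ ≤_) gcd≡n (splitPart⇒≤gcd fat (rep₀≁rep₁ 1<θ) split))
    , (λ 1≮θ → ≤-trans (surjective⇒≤ c (proj₁ fat)) (≤-reflexive (N≡n 1≮θ))) ]′ (toSum (1 ℕ.<? θ zero))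
    where
    N≡n : ¬ 1 < θ zero → N ≡ n zero
    N≡n 1≮θ = trans N≡θn (trans (cong (_* n zero) (θ≡1 1≮θ)) (+-identityʳ (n zero)))

  theorem : FATChromaticNumber≡ G (θ zero ⊔ n zero)
  theorem = lower (θ zero ℕ.≤? n zero) , upper
    where
    lower : Dec (θ zero ≤ n zero) → HasFATColoring G (θ zero ⊔ n zero)
    lower (yes θ≤n) = subst (HasFATColoring G) (trans gcd≡n (sym (m≤n⇒m⊔n≡n θ≤n)))
      (hasFAT-gcd (proj₁ (representative (zero , fromℕ< (θ>0 zero)))))
    lower (no θ≰n) = subst (HasFATColoring G) (sym (m≥n⇒m⊔n≡m (<⇒≤ n<θ)))
      (partColouring , partColouring-isFAT (≤-trans (s≤s (n>0 zero)) n<θ))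
      where
      n<θ : n zero < θ zero
      n<θ = ≰⇒> θ≰n
    upper : ∀ k → HasFATColoring G k → k ≤ θ zero ⊔ n zero
    upper k (c , fat) = [ (λ constant → ≤-trans (partwiseConstant⇒≤θ fat constant) (m≤m⊔n (θ zero) (n zero)))
                        , (λ split → ≤-trans (splitPart⇒≤n fat split) (m≤n⊔m (θ zero) (n zero))) ]′ (partwiseConstant? c)

module TwoGroups {N} {n θ : Fin 2 → ℕ} {G : Graph N} {part : Fin N → PartLabel 2 θ}
  (multipartite : IsCompleteMultipartite 2 n θ G part)
  (n>0 : ∀ a → 0 < n a) (θ>0 : ∀ a → 0 < θ a) (increasing : ∀ a b → b Fin.< a → n b < n a) where

  open AtLeastTwoGroups {N} {0} {n} {θ} {G} {part} multipartite n>0 θ>0 increasing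
  open Colouring using (colourCount; eClass-partwiseConstant)

  balance : Fin 2 → ℕ
  balance a = θ a * (θ a ∸ 1) * (n a * n a)

  Balanced : Set
  Balanced = balance zero ≡ balance (suc zero)

  A B : ℕ
  A = θ zero * n zero
  B = θ (suc zero) * n (suc zero)

  N≡A+B : N ≡ A + B
  N≡A+B = begin
    N
      ≡⟨ count-all {N} (λ _ → true) (λ _ → refl) ⟨
    count {N} (λ _ → true)
      ≡⟨ count-partition group (λ _ → true) ⟩
    colourCount group zero + (colourCount group (suc zero) + 0)
      ≡⟨ cong₂ _+_ (groupSize zero) (trans (+-identityʳ _) (groupSize (suc zero))) ⟩
    A + B ∎
    where open ≡-Reasoning

  deg-byGroup : ∀ v → deg G v ≡ deg G (groupRep (group v))
  deg-byGroup v = +-cancelˡ-≡ (n (group v)) _ _ (begin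
    n (group v) + deg G v       ≡⟨ partSize+deg v ⟩
    N                           ≡⟨ partSize+deg r ⟨
    n (group r) + deg G r       ≡⟨ cong (λ a → n a + deg G r) (group-groupRep (group v)) ⟩
    n (group v) + deg G r       ∎)
    where
    open ≡-Reasoning
    r = groupRep (group v)

  d₀ d₁ : ℕ
  d₀ = deg G r₀
  d₁ = deg G r₁

  n₀+d₀ : n zero + d₀ ≡ A + B
  n₀+d₀ = trans (cong (λ a → n a + d₀) (sym (group-groupRep zero))) (trans (partSize+deg r₀) N≡A+B)

  n₁+d₁ : n (suc zero) + d₁ ≡ B + A
  n₁+d₁ = trans (cong (λ a → n a + d₁) (sym (group-groupRep (suc zero)))) (trans (partSize+deg r₁) (trans N≡A+B (+-comm A B)))

  A*d₀≡ : A * d₀ ≡ balance zero + A * B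
  A*d₀≡ = square-split (θ zero) (n zero) d₀ B (θ>0 zero) n₀+d₀

  B*d₁≡ : B * d₁ ≡ balance (suc zero) + B * A
  B*d₁≡ = square-split (θ (suc zero)) (n (suc zero)) d₁ A (θ>0 (suc zero)) n₁+d₁

  balanced⇒A*d₀≡B*d₁ : Balanced → A * d₀ ≡ B * d₁
  balanced⇒A*d₀≡B*d₁ balanced = trans A*d₀≡ (trans (cong₂ _+_ balanced (*-comm A B)) (sym B*d₁≡))

  B*d₁≡A*d₀⇒balanced : B * d₁ ≡ A * d₀ → Balanced
  B*d₁≡A*d₀⇒balanced B*d₁≡A*d₀ = +-cancelʳ-≡ (A * B) _ _
    (trans (sym A*d₀≡) (trans (sym B*d₁≡A*d₀) (trans B*d₁≡ (cong (balance (suc zero) +_) (*-comm B A)))))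

  groupColouring-isFAT : Balanced → IsFATColoring G 2 group
  groupColouring-isFAT balanced =
    isFATColoring-byRatio G group (λ a → groupRep a , group-groupRep a) B d₀ {{d₀≢0}} B≤d₀ λ v →
      colourCount group (other (group v)) ,
      (λ i gv≢i → trans (eClass-partwiseConstant group (λ _ _ → cong proj₁) v i gv≢i)
                        (cong (colourCount group) (≢⇒≡other gv≢i))) ,
      ratio-eq (group v) (deg-byGroup v)
    where
    d₀≢0 : NonZero d₀
    d₀≢0 = >-nonZero (deg-pos r₀≁r₁ r₀)
    B≤d₀ : B ≤ d₀
    B≤d₀ = +-cancelˡ-≤ (n zero) B d₀
      (≤-trans (+-monoˡ-≤ B (m≤n*m (n zero) (θ zero) {{>-nonZero (θ>0 zero)}})) (≤-reflexive (sym n₀+d₀)))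
    ratio-eq : ∀ a {d} → d ≡ deg G (groupRep a) → colourCount group (other a) * d₀ ≡ B * d
    ratio-eq zero refl = cong (_* d₀) (groupSize (suc zero))
    ratio-eq (suc zero) refl = trans (cong (_* d₀) (groupSize zero)) (balanced⇒A*d₀≡B*d₁ balanced)

  partwiseConstant⇒balanced : ∀ {c : Fin N → Fin 2} → IsFATColoring G 2 c → PartwiseConstant c → Balanced
  partwiseConstant⇒balanced {c} fat constant =
    B*d₁≡A*d₀⇒balanced (ℕtoℚ-cross α B d₀ A d₁ (sees-other zero) (sees-other (suc zero)))
    where
    open FATColouring fat using (α; offDiagonal)
    sameColour⇒sameGroup : ∀ {v w} → c v ≡ c w → group v ≡ group w
    sameColour⇒sameGroup same = n-injective (sameColour⇒sameSize fat constant same)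
    other≢ : ∀ a → other a ≢ a
    other≢ zero ()
    other≢ (suc zero) ()
    colours-differ : ∀ a → c (groupRep a) ≢ c (groupRep (other a))
    colours-differ a same = other≢ a (sym (group-groupRep-injective (sameColour⇒sameGroup same)))
    colourClass≡group : ∀ a w → ⌊ c w ≟ c (groupRep a) ⌋ ≡ ⌊ group w ≟ a ⌋
    colourClass≡group a w =
      ⌊⌋-⇔ (λ same → trans (sameColour⇒sameGroup same) (group-groupRep a)) inClass (c w ≟ c (groupRep a)) (group w ≟ a)
      where
      inClass : group w ≡ a → c w ≡ c (groupRep a)
      inClass gw≡a = decidable-stable (c w ≟ c (groupRep a)) λ differ →
        other≢ a (trans (sym (group-groupRep (other a))) (trans (sym (sameColour⇒sameGroup
          (trans (≢⇒≡other (differ ∘ sym)) (sym (≢⇒≡other (colours-differ a)))))) gw≡a))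
    sees-other : ∀ a → ℕtoℚ (θ (other a) * n (other a)) ≡ α ℚ.* ℕtoℚ (deg G (groupRep a))
    sees-other a = begin
      ℕtoℚ (θ (other a) * n (other a))
        ≡⟨ cong ℕtoℚ (trans (count-cong (colourClass≡group (other a))) (groupSize (other a))) ⟨
      ℕtoℚ (colourCount c (c (groupRep (other a))))
        ≡⟨ cong ℕtoℚ (eClass-partwiseConstant c constant (groupRep a) (c (groupRep (other a))) (colours-differ a)) ⟨
      ℕtoℚ (eClass G c (groupRep a) (c (groupRep (other a))))
        ≡⟨ offDiagonal (groupRep a) (c (groupRep (other a))) (colours-differ a) ⟩
      α ℚ.* ℕtoℚ (deg G (groupRep a)) ∎
      where open ≡-Reasoning

  gcd≡ : gcdAll n ≡ gcd (n zero) (n (suc zero))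
  gcd≡ = cong (gcd (n zero)) (gcd-identityʳ (n (suc zero)))

  value-cases : (gcdAll n ≡ 1 × Balanced × fatValue 2 n θ ≡ 2) ⊎ (fatValue 2 n θ ≡ gcdAll n × (gcdAll n ≡ 1 → ¬ Balanced))
  value-cases with gcd (n zero) (n (suc zero)) ℕ.≡ᵇ 1 in coprime
                 | θ zero * (θ zero ∸ 1) * (n zero * n zero) ℕ.≡ᵇ θ (suc zero) * (θ (suc zero) ∸ 1) * (n (suc zero) * n (suc zero)) in balancedᵇ
  ... | true | true = inj₁ (trans gcd≡ (≡ᵇ-sound coprime) , ≡ᵇ-sound balancedᵇ , refl)
  ... | true | false = inj₂ (refl , λ _ balanced → contradiction (trans (sym balancedᵇ) (≡ᵇ-complete balanced)) λ ())
  ... | false | _ = inj₂ (refl , λ gcd≡1 _ → contradiction (trans (sym coprime) (≡ᵇ-complete (trans (sym gcd≡) gcd≡1))) λ ())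

  gcd≤value : gcdAll n ≤ fatValue 2 n θ
  gcd≤value with value-cases
  ... | inj₁ (gcd≡1 , _ , value≡2) = subst₂ _≤_ (sym gcd≡1) (sym value≡2) (s≤s z≤n)
  ... | inj₂ (value≡gcd , _) = ≤-reflexive (sym value≡gcd)

  balanced⇒2≤value : Balanced → 2 ≤ fatValue 2 n θ
  balanced⇒2≤value balanced with value-cases
  ... | inj₁ (_ , _ , value≡2) = ≤-reflexive (sym value≡2)
  ... | inj₂ (value≡gcd , unbalanced) = subst (2 ≤_) (sym value≡gcd)
    (≤∧≢⇒< (gcdAll-pos n (n>0 zero)) λ 1≡gcd → unbalanced (sym 1≡gcd) balanced)

  hasFAT-value : HasFATColoring G (fatValue 2 n θ)
  hasFAT-value = [ (λ { (_ , balanced , value≡2) → subst (HasFATColoring G) (sym value≡2) (group , groupColouring-isFAT balanced) })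
                 , (λ { (value≡gcd , _) → subst (HasFATColoring G) (sym value≡gcd) (hasFAT-gcd r₀) }) ]′ value-cases

  partwiseConstant⇒≤value : ∀ {k} {c : Fin N → Fin k} → IsFATColoring G k c → PartwiseConstant c → k ≤ fatValue 2 n θ
  partwiseConstant⇒≤value {zero} _ _ = z≤n
  partwiseConstant⇒≤value {suc zero} _ _ = ≤-trans (gcdAll-pos n (n>0 zero)) gcd≤value
  partwiseConstant⇒≤value {suc (suc zero)} fat constant = balanced⇒2≤value (partwiseConstant⇒balanced fat constant)
  partwiseConstant⇒≤value {suc (suc (suc _))} fat constant = contradiction (partwiseConstant⇒≤2 fat constant) λ { (s≤s (s≤s ())) }

  theorem : FATChromaticNumber≡ G (fatValue 2 n θ)
  theorem = hasFAT-value , upper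
    where
    upper : ∀ k → HasFATColoring G k → k ≤ fatValue 2 n θ
    upper k (c , fat) = [ partwiseConstant⇒≤value fat , (λ split → ≤-trans (splitPart⇒≤gcd fat r₀≁r₁ split) gcd≤value) ]′
                          (partwiseConstant? c)

module ThreeOrMoreGroups {N p} {n θ : Fin (3 + p) → ℕ} {G : Graph N} {part : Fin N → PartLabel (3 + p) θ}
  (multipartite : IsCompleteMultipartite (3 + p) n θ G part)
  (n>0 : ∀ a → 0 < n a) (θ>0 : ∀ a → 0 < θ a) (increasing : ∀ a b → b Fin.< a → n b < n a) where

  open AtLeastTwoGroups {N} {suc p} {n} {θ} {G} {part} multipartite n>0 θ>0 increasing

  partwiseConstant⇒≤1 : ∀ {k} {c : Fin N → Fin k} → IsFATColoring G k c → PartwiseConstant c → k ≤ 1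
  partwiseConstant⇒≤1 {zero} _ _ = z≤n
  partwiseConstant⇒≤1 {suc zero} _ _ = ≤-refl
  partwiseConstant⇒≤1 {suc (suc zero)} fat constant = contradiction (#groups≤#colours fat constant n-injective) λ { (s≤s (s≤s ())) }
  partwiseConstant⇒≤1 {suc (suc (suc _))} fat constant = contradiction (partwiseConstant⇒≤2 fat constant) λ { (s≤s (s≤s ())) }

  theorem : FATChromaticNumber≡ G (gcdAll n)
  theorem = hasFAT-gcd r₀ , upper
    where
    upper : ∀ k → HasFATColoring G k → k ≤ gcdAll n
    upper k (c , fat) = [ (λ constant → ≤-trans (partwiseConstant⇒≤1 fat constant) (gcdAll-pos n (n>0 zero)))
                        , splitPart⇒≤gcd fat r₀≁r₁ ]′ (partwiseConstant? c)

mainTheorem1 : (p : ℕ) → 1 ≤ p → (n θ : Fin p → ℕ) →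
    (∀ i → 0 < n i) → (∀ i j → j Fin.< i → n j < n i) → (∀ i → 0 < θ i) →
    ∀ {N} (G : Graph N) (part : Fin N → PartLabel p θ) →
    IsCompleteMultipartite p n θ G part →
    FATChromaticNumber≡ G (fatValue p n θ)
mainTheorem1 zero ()
mainTheorem1 (suc zero) _ n θ n>0 _ θ>0 G part multipartite =
  OneGroup.theorem {n = n} {θ} {G} {part} multipartite n>0 θ>0
mainTheorem1 (suc (suc zero)) _ n θ n>0 increasing θ>0 G part multipartite =
  TwoGroups.theorem {n = n} {θ} {G} {part} multipartite n>0 θ>0 increasing
mainTheorem1 (suc (suc (suc p))) _ n θ n>0 increasing θ>0 G part multipartite =
  ThreeOrMoreGroups.theorem {p = p} {n} {θ} {G} {part} multipartite n>0 θ>0 increasing
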